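{- Let $S \subseteq \mathbb{N}^+$. Then $S$ is $(n+O(1))$-nongappy if and only if $S$ is nongappy$_{\mathrm{value}}$.
   Context: Natural numbers are identified with their binary representations; for $m \in \mathbb{N}^+$, $|m|$ denotes the length of the binary representation of $m$. A set $S \subseteq \mathbb{N}^+$ is nongappy$_{\mathrm{value}}$ if $S \neq \emptyset$ and there exists $k>0$ such that for every $m \in S$ there exists $m' \in S$ with $m' > m$ and $m'/m \le k$. A set $S \subseteq \mathbb{N}^+$ is $(n+O(1))$-nongappy if $S \neq \emptyset$ and there exists a function $f \in O(1)$ such that for every $m \in S$ there exists $m' \in S$ with $m' > m$ and $|m'| \le |m| + f(|m|)$. -}

module Defs where

open import Level using (0ℓ)
open import Data.Nat using (ℕ; suc; _+_; _*_; _≤_; _<_)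
open import Data.Nat.Logarithm using (⌊log₂_⌋)
open import Data.Product using (Σ; ∃; _×_)
open import Relation.Unary using (Pred)

bitLength : ℕ → ℕ
bitLength m = suc ⌊log₂ m ⌋

PositiveSet : Pred ℕ 0ℓ → Set
PositiveSet S = ∀ m → S m → 0 < m

NonEmpty : Pred ℕ 0ℓ → Set
NonEmpty S = ∃ λ m → S m

IsO1 : (ℕ → ℕ) → Set
IsO1 f = ∃ λ c → ∃ λ n₀ → ∀ n → n₀ ≤ n → f n ≤ c

-- nongappy_value : S ≠ ∅ and ∃ k > 0, ∀ m ∈ S, ∃ m' ∈ S, m' > m and m'/m ≤ k
-- (m'/m ≤ k  ⇔  m' ≤ k * m since m > 0; k ranges over ℕ)
NongappyValue : Pred ℕ 0ℓ → Set
NongappyValue S = NonEmpty S ×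
  (∃ λ k → 0 < k × (∀ m → S m → ∃ λ m' → S m' × m < m' × m' ≤ k * m))

NongappyLength : Pred ℕ 0ℓ → Set
NongappyLength S = NonEmpty S ×
  (∃ λ f → IsO1 f × (∀ m → S m → ∃ λ m' → S m' × m < m' × bitLength m' ≤ bitLength m + f (bitLength m)))

-- A value bound m′ ≤ k·m and a length bound |m′| ≤ |m| + c are interchangeable because
-- 2^(|m|-1) ≤ m < 2^|m|: the first gives |m′| ≤ |m| + |k|, the second m′ < 2^(c+1)·m.
-- The only other ingredient is that an eventually bounded function is bounded everywhere,
-- which makes the O(1) slack of a length bound a constant.
module Submission where

open import Defs
open import Level using (0ℓ)
open import Data.Nat
open import Data.Nat.Properties
open import Data.Nat.Logarithm
open import Data.Product using (_×_; _,_; ∃)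
open import Data.Sum using (inj₁; inj₂)
open import Relation.Nullary using (yes; no; contradiction)
open import Relation.Unary using (Pred)
open import Relation.Binary.PropositionalEquality

2*⌊n/2⌋≤n : ∀ n → 2 * ⌊ n /2⌋ ≤ n
2*⌊n/2⌋≤n n = begin
  2 * ⌊ n /2⌋         ≡⟨ cong (⌊ n /2⌋ +_) (+-identityʳ ⌊ n /2⌋) ⟩
  ⌊ n /2⌋ + ⌊ n /2⌋   ≤⟨ +-monoʳ-≤ ⌊ n /2⌋ (⌊n/2⌋≤⌈n/2⌉ n) ⟩
  ⌊ n /2⌋ + ⌈ n /2⌉   ≡⟨ ⌊n/2⌋+⌈n/2⌉≡n n ⟩
  n                   ∎
  where open ≤-Reasoning

2^⌊log₂n⌋≤n : ∀ n .{{_ : NonZero n}} → 2 ^ ⌊log₂ n ⌋ ≤ n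
2^⌊log₂n⌋≤n n = go ⌊log₂ n ⌋ n refl
  where
  go : ∀ l n .{{_ : NonZero n}} → ⌊log₂ n ⌋ ≡ l → 2 ^ l ≤ n
  go zero    n             _   = >-nonZero⁻¹ n
  go (suc l) n@(suc (suc _)) eq = begin
    2 * 2 ^ l     ≤⟨ *-monoʳ-≤ 2 (go l ⌊ n /2⌋ halved) ⟩
    2 * ⌊ n /2⌋   ≤⟨ 2*⌊n/2⌋≤n n ⟩
    n             ∎
    where
    open ≤-Reasoning
    halved : ⌊log₂ ⌊ n /2⌋ ⌋ ≡ l
    halved = trans (⌊log₂⌊n/2⌋⌋≡⌊log₂n⌋∸1 n) (cong (_∸ 1) eq)

n<2^bitLength[n] : ∀ n → n < 2 ^ bitLength n
n<2^bitLength[n] n with n <? 2 ^ bitLength n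
... | yes n<2^l = n<2^l
... | no  n≮2^l = contradiction (⌊log₂⌋-mono-≤ (≮⇒≥ n≮2^l)) (<⇒≱ (begin-strict
  ⌊log₂ n ⌋                   <⟨ n<1+n ⌊log₂ n ⌋ ⟩
  bitLength n                 ≡⟨ ⌊log₂[2^n]⌋≡n (bitLength n) ⟨
  ⌊log₂ (2 ^ bitLength n) ⌋   ∎))
  where
  open ≤-Reasoning

⌊log₂[2^k*n]⌋≡k+⌊log₂n⌋ : ∀ k n .{{_ : NonZero n}} → ⌊log₂ (2 ^ k * n) ⌋ ≡ k + ⌊log₂ n ⌋
⌊log₂[2^k*n]⌋≡k+⌊log₂n⌋ zero    n = cong ⌊log₂_⌋ (+-identityʳ n)
⌊log₂[2^k*n]⌋≡k+⌊log₂n⌋ (suc k) n = begin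
  ⌊log₂ (2 * 2 ^ k * n) ⌋     ≡⟨ cong ⌊log₂_⌋ (*-assoc 2 (2 ^ k) n) ⟩
  ⌊log₂ (2 * (2 ^ k * n)) ⌋   ≡⟨ ⌊log₂[2*b]⌋≡1+⌊log₂b⌋ (2 ^ k * n) {{m*n≢0 (2 ^ k) n {{m^n≢0 2 k}}}} ⟩
  suc ⌊log₂ (2 ^ k * n) ⌋     ≡⟨ cong suc (⌊log₂[2^k*n]⌋≡k+⌊log₂n⌋ k n) ⟩
  suc (k + ⌊log₂ n ⌋)         ∎
  where open ≡-Reasoning

m≤2^k*n⇒bitLength[m]≤bitLength[n]+k : ∀ {m n} k .{{_ : NonZero n}} →
  m ≤ 2 ^ k * n → bitLength m ≤ bitLength n + k
m≤2^k*n⇒bitLength[m]≤bitLength[n]+k {m} {n} k m≤2^kn = s≤s (begin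
  ⌊log₂ m ⌋             ≤⟨ ⌊log₂⌋-mono-≤ m≤2^kn ⟩
  ⌊log₂ (2 ^ k * n) ⌋   ≡⟨ ⌊log₂[2^k*n]⌋≡k+⌊log₂n⌋ k n ⟩
  k + ⌊log₂ n ⌋         ≡⟨ +-comm k ⌊log₂ n ⌋ ⟩
  ⌊log₂ n ⌋ + k         ∎)
  where open ≤-Reasoning

bitLength[m]≤bitLength[n]+k⇒m<2^[1+k]*n : ∀ {m n} k .{{_ : NonZero n}} →
  bitLength m ≤ bitLength n + k → m < 2 ^ suc k * n
bitLength[m]≤bitLength[n]+k⇒m<2^[1+k]*n {m} {n} k |m|≤|n|+k = begin-strict
  m                               <⟨ n<2^bitLength[n] m ⟩
  2 ^ bitLength m                 ≤⟨ ^-monoʳ-≤ 2 |m|≤1+k+⌊log₂n⌋ ⟩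
  2 ^ (suc k + ⌊log₂ n ⌋)         ≡⟨ ^-distribˡ-+-* 2 (suc k) ⌊log₂ n ⌋ ⟩
  2 ^ suc k * 2 ^ ⌊log₂ n ⌋       ≤⟨ *-monoʳ-≤ (2 ^ suc k) (2^⌊log₂n⌋≤n n) ⟩
  2 ^ suc k * n                   ∎
  where
  open ≤-Reasoning
  |m|≤1+k+⌊log₂n⌋ : bitLength m ≤ suc k + ⌊log₂ n ⌋
  |m|≤1+k+⌊log₂n⌋ = ≤-trans |m|≤|n|+k (≤-reflexive (cong suc (+-comm ⌊log₂ n ⌋ k)))

bounded-on-< : ∀ (f : ℕ → ℕ) n₀ → ∃ λ b → ∀ {n} → n < n₀ → f n ≤ b
bounded-on-< f zero     = 0 , λ ()
bounded-on-< f (suc n₀) with bounded-on-< f n₀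
... | b , f≤b = b ⊔ f n₀ , bound
  where
  bound : ∀ {n} → n < suc n₀ → f n ≤ b ⊔ f n₀
  bound {n} n<1+n₀ with m≤n⇒m<n∨m≡n (s≤s⁻¹ n<1+n₀)
  ... | inj₁ n<n₀ = ≤-trans (f≤b n<n₀) (m≤m⊔n b (f n₀))
  ... | inj₂ refl = m≤n⊔m b (f n₀)

IsO1⇒bounded : ∀ {f} → IsO1 f → ∃ λ b → ∀ n → f n ≤ b
IsO1⇒bounded {f} (c , n₀ , f≤c) with bounded-on-< f n₀
... | b , f≤b = c ⊔ b , bound
  where
  bound : ∀ n → f n ≤ c ⊔ b
  bound n with n₀ ≤? n
  ... | yes n₀≤n = ≤-trans (f≤c n n₀≤n) (m≤m⊔n c b)
  ... | no  n₀≰n = ≤-trans (f≤b (≰⇒> n₀≰n)) (m≤n⊔m c b)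

nongappyLength⇒nongappyValue : ∀ {S : Pred ℕ 0ℓ} → PositiveSet S → NongappyLength S → NongappyValue S
nongappyLength⇒nongappyValue {S} pos (nonEmpty , f , f∈O1 , next) with IsO1⇒bounded f∈O1
... | b , f≤b = nonEmpty , 2 ^ suc b , m^n>0 2 (suc b) , nextWithin
  where
  nextWithin : ∀ m → S m → ∃ λ m′ → S m′ × m < m′ × m′ ≤ 2 ^ suc b * m
  nextWithin m Sm with next m Sm
  ... | m′ , Sm′ , m<m′ , |m′|≤|m|+f = m′ , Sm′ , m<m′ ,
    <⇒≤ (bitLength[m]≤bitLength[n]+k⇒m<2^[1+k]*n b {{>-nonZero (pos m Sm)}}
           (≤-trans |m′|≤|m|+f (+-monoʳ-≤ (bitLength m) (f≤b (bitLength m)))))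

nongappyValue⇒nongappyLength : ∀ {S : Pred ℕ 0ℓ} → PositiveSet S → NongappyValue S → NongappyLength S
nongappyValue⇒nongappyLength {S} pos (nonEmpty , k , _ , next) =
  nonEmpty , (λ _ → bitLength k) , (bitLength k , 0 , λ _ _ → ≤-refl) , nextWithin
  where
  nextWithin : ∀ m → S m → ∃ λ m′ → S m′ × m < m′ × bitLength m′ ≤ bitLength m + bitLength k
  nextWithin m Sm with next m Sm
  ... | m′ , Sm′ , m<m′ , m′≤km = m′ , Sm′ , m<m′ ,
    m≤2^k*n⇒bitLength[m]≤bitLength[n]+k (bitLength k) {{>-nonZero (pos m Sm)}}
      (≤-trans m′≤km (*-monoˡ-≤ m (<⇒≤ (n<2^bitLength[n] k))))

proposition2p5 : (S : Pred ℕ 0ℓ) → PositiveSet S →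
    (NongappyLength S → NongappyValue S) × (NongappyValue S → NongappyLength S)
proposition2p5 S pos = nongappyLength⇒nongappyValue pos , nongappyValue⇒nongappyLength pos
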